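{- For every integer $d\ge 2$, $\gamma(cDB(d,2,2))=d-1$.
   Context: Let $[d]=\{1,\dots,d\}$. A sequence $(x_1,\dots,x_n)\in[d]^n$ is $t$-constrained if for all $1\le i<j\le n$ with $x_i=x_j$ one has $j-i\ge t$ (so $2$-constrained means no two consecutive entries are equal). For $1\le t\le\min\{d,n\}$, $V(d,t,n)$ denotes the set of $t$-constrained sequences in $[d]^n$. The directed $t$-constrained de Bruijn graph $cDB^+(d,t,n)$ is the subgraph of the directed de Bruijn graph on $[d]^n$ (arcs $(a_1,\dots,a_n)\to(a_2,\dots,a_n,a_{n+1})$) induced by $V(d,t,n)$; $cDB(d,t,n)$ is its undirected version, obtained by ignoring arc directions and removing loops and multiple edges. In an undirected graph a vertex dominates itself and its neighbours; a dominating set is a set $S$ of vertices such that every vertex is dominated by some vertex of $S$, and $\gamma(G)$ is the minimum size of a dominating set. -}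

module Defs where

open import Data.Nat using (ℕ; _≤_; _<_; _∸_; suc)
open import Data.Fin using (Fin; toℕ)
open import Data.Vec using (Vec; lookup)
open import Data.Product using (Σ; proj₁)
open import Data.Sum using (_⊎_)
open import Data.List using (List; length)
open import Data.List.Relation.Unary.Any using (Any)
open import Data.List.Relation.Unary.AllPairs using (AllPairs)
open import Relation.Nullary using (¬_)
open import Relation.Binary.PropositionalEquality using (_≡_; _≢_)

Seq : ℕ → ℕ → Set
Seq d n = Vec (Fin d) n

Constrained : ∀ {d n} → ℕ → Seq d n → Set
Constrained {n = n} t x =
  (i j : Fin n) → toℕ i < toℕ j → lookup x i ≡ lookup x j → t ≤ toℕ j ∸ toℕ i

V : ℕ → ℕ → ℕ → Set
V d t n = Σ (Seq d n) (Constrained t)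

-- Directed de Bruijn arc a → b : (a₁,…,aₙ) → (a₂,…,aₙ,b_n), i.e. b_i = a_{i+1}.
DBArc : ∀ {d n} → Seq d n → Seq d n → Set
DBArc {n = n} a b = (i j : Fin n) → toℕ j ≡ suc (toℕ i) → lookup b i ≡ lookup a j

record Graph : Set₁ where
  field
    Vertex : Set
    _≈_    : Vertex → Vertex → Set
    Adj    : Vertex → Vertex → Set

-- cDB(d,t,n): undirected version of the induced subgraph on V(d,t,n),
-- loops removed (multiple edges are irrelevant for a relation).
cDB : ℕ → ℕ → ℕ → Graph
cDB d t n = record
  { Vertex = V d t n
  ; _≈_    = λ u v → proj₁ u ≡ proj₁ v
  ; Adj    = λ u v → proj₁ u ≢ proj₁ v
                     × (DBArc (proj₁ u) (proj₁ v) ⊎ DBArc (proj₁ v) (proj₁ u))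
  }
  where open import Data.Product using (_×_)

module _ (G : Graph) where
  open Graph G

  Dominates : Vertex → Vertex → Set
  Dominates u v = u ≈ v ⊎ Adj u v

  IsDominating : List Vertex → Set
  IsDominating S = (v : Vertex) → Any (λ u → Dominates u v) S

  DominationNumber : ℕ → Set
  DominationNumber k =
    Σ (List Vertex) (λ S → AllPairs (λ u v → ¬ (u ≈ v)) S × IsDominating S × length S ≡ k)
    × ((S : List Vertex) → IsDominating S → k ≤ length S)
    where open import Data.Product using (_×_)

-- A vertex of cDB(d,2,2) is a pair (a,b) with a ≠ b; its neighbours are the pairs
-- (b,c) and (c,a).  The d − 1 vertices (k,0), k ≠ 0, dominate, since (a,k) is
-- either (k,0) itself or an in-neighbour of it.  Conversely, let S dominate.  If
-- every symbol is the first entry of some member of S, then |S| ≥ d.  Otherwise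
-- pick a symbol y that is no first entry: each (c,y) with c ≠ y is dominated by
-- itself or by a pair ending in c, so the map sending u ∈ S to its last entry,
-- or to its first entry when the last one is y, hits all d − 1 symbols c ≠ y.
module Submission where

open import Defs
open import Data.Nat using (ℕ; _≤_; _∸_; zero; suc; z≤n; s≤s)
open import Data.Fin using (Fin; zero; suc; punchIn; _≟_)
open import Data.Fin.Properties
  using (injective⇒≤; all?; ¬∀⟶∃¬; punchInᵢ≢i; punchIn-injective; suc-injective)
open import Data.Vec using (lookup; _∷_; [])
open import Data.Product using (proj₁; _,_; _×_)
open import Data.Sum using (_⊎_; inj₁; inj₂; [_,_]′)
open import Data.List using (List; length; tabulate)
import Data.List as List
open import Data.List.Properties using (length-tabulate)
open import Data.List.Relation.Unary.Any using (Any; index; any?)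
import Data.List.Relation.Unary.Any as Any
open import Data.List.Relation.Unary.AllPairs using (AllPairs)
open import Data.List.Relation.Unary.Any.Properties using (lookup-index; Any-⊎⁻)
import Data.List.Relation.Unary.Any.Properties as Anyₚ
import Data.List.Relation.Unary.AllPairs.Properties as AllPairsₚ
open import Function using (id; _∘_)
open import Function.Definitions using (Injective)
open import Relation.Nullary using (¬_; yes; no)
open import Relation.Binary.PropositionalEquality using (_≡_; _≢_; refl; sym; trans; cong; module ≡-Reasoning)
open import Data.Empty using (⊥-elim)

V₂ : ℕ → Set
V₂ d = V d 2 2

first : ∀ {d} → V₂ d → Fin d
first u = lookup (proj₁ u) zero

second : ∀ {d} → V₂ d → Fin d
second u = lookup (proj₁ u) (suc zero)

pair : ∀ {d} (a b : Fin d) → a ≢ b → V₂ d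
pair a b a≢b = (a ∷ b ∷ []) , constrained
  where
  constrained : Constrained 2 (a ∷ b ∷ [])
  constrained zero       (suc zero) _       a≡b = ⊥-elim (a≢b a≡b)
  constrained (suc zero) (suc zero) (s≤s ()) _

DBArc-shift : ∀ {d} (a b c : Fin d) → DBArc (a ∷ b ∷ []) (b ∷ c ∷ [])
DBArc-shift a b c zero (suc zero) _ = refl

dominator-of-pair : ∀ {d} {c y : Fin d} (c≢y : c ≢ y) (u : V₂ d) →
                    Dominates (cDB d 2 2) u (pair c y c≢y) →
                    (first u ≡ c × second u ≡ y) ⊎ second u ≡ c ⊎ first u ≡ y
dominator-of-pair c≢y u (inj₁ u≡cy) =
  inj₁ (cong (λ s → lookup s zero) u≡cy , cong (λ s → lookup s (suc zero)) u≡cy)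
dominator-of-pair c≢y u (inj₂ (_ , inj₁ u→cy)) = inj₂ (inj₁ (sym (u→cy zero (suc zero) refl)))
dominator-of-pair c≢y u (inj₂ (_ , inj₂ cy→u)) = inj₂ (inj₂ (cy→u zero (suc zero) refl))

label : ∀ {d} → Fin d → V₂ d → Fin d
label y u with second u ≟ y
... | yes _ = first u
... | no  _ = second u

dominator-label : ∀ {d} {c y : Fin d} (c≢y : c ≢ y) (u : V₂ d) →
                  Dominates (cDB d 2 2) u (pair c y c≢y) → label y u ≡ c ⊎ first u ≡ y
dominator-label {y = y} c≢y u dom with second u ≟ y | dominator-of-pair c≢y u dom
... | _       | inj₂ (inj₂ first≡y) = inj₂ first≡y
... | yes _   | inj₁ (first≡c , _)  = inj₁ first≡c
... | yes s≡y | inj₂ (inj₁ s≡c)     = ⊥-elim (c≢y (trans (sym s≡c) s≡y))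
... | no s≢y  | inj₁ (_ , s≡y)      = ⊥-elim (s≢y s≡y)
... | no _    | inj₂ (inj₁ s≡c)     = inj₁ s≡c

cover⇒≤ : ∀ {A B : Set} {m} (f : A → B) {ι : Fin m → B} → Injective _≡_ _≡_ ι →
          (S : List A) → (∀ k → Any (λ u → f u ≡ ι k) S) → m ≤ length S
cover⇒≤ f {ι} ι-injective S cover = injective⇒≤ position-injective
  where
  position-injective : Injective _≡_ _≡_ (λ k → index (cover k))
  position-injective {a} {b} eq = ι-injective (begin
    ι a                                 ≡⟨ sym (lookup-index (cover a)) ⟩
    f (List.lookup S (index (cover a))) ≡⟨ cong (λ i → f (List.lookup S i)) eq ⟩
    f (List.lookup S (index (cover b))) ≡⟨ lookup-index (cover b) ⟩
    ι b                                 ∎)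
    where open ≡-Reasoning

labels-cover : ∀ {e} (S : List (V₂ (suc e))) → IsDominating (cDB (suc e) 2 2) S →
               ∀ {y} → ¬ Any (λ u → first u ≡ y) S →
               (k : Fin e) → Any (λ u → label y u ≡ punchIn y k) S
labels-cover S dom {y} no-first-y k =
  [ id , ⊥-elim ∘ no-first-y ]′
    (Any-⊎⁻ (Any.map (dominator-label c≢y _) (dom (pair _ y c≢y))))
  where
  c≢y : punchIn y k ≢ y
  c≢y = punchInᵢ≢i y k

dominating⇒≥ : ∀ d (S : List (V₂ d)) → IsDominating (cDB d 2 2) S → d ∸ 1 ≤ length S
dominating⇒≥ zero    S dom = z≤n
dominating⇒≥ (suc e) S dom with all? (λ y → any? (λ u → first u ≟ y) S)
... | yes firsts-cover =
  cover⇒≤ first (punchIn-injective zero _ _) S (λ k → firsts-cover (punchIn zero k))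
... | no ¬firsts-cover with ¬∀⟶∃¬ _ _ (λ y → any? (λ u → first u ≟ y) S) ¬firsts-cover
...   | y , no-first-y =
  cover⇒≤ (label y) (punchIn-injective y _ _) S (labels-cover S dom no-first-y)

star-vertex : ∀ e → Fin (suc e) → V₂ (suc (suc e))
star-vertex e k = pair (suc k) zero λ ()

star : ∀ e → List (V₂ (suc (suc e)))
star e = tabulate (star-vertex e)

star-dominating : ∀ e → IsDominating (cDB (suc (suc e)) 2 2) (star e)
star-dominating e ((zero ∷ zero ∷ []) , constrained)
  with constrained zero (suc zero) (s≤s z≤n) refl
... | s≤s ()
star-dominating e ((suc k ∷ zero ∷ []) , _) = Anyₚ.tabulate⁺ {f = star-vertex e} k (inj₁ refl)
star-dominating e ((a ∷ suc k ∷ []) , _) =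
  Anyₚ.tabulate⁺ {f = star-vertex e} k (inj₂ ((λ ()) , inj₂ (DBArc-shift a (suc k) zero)))

star-distinct : ∀ e → AllPairs (λ u v → proj₁ u ≢ proj₁ v) (star e)
star-distinct e = AllPairsₚ.tabulate⁺ {f = star-vertex e}
  (λ k≢l same → k≢l (suc-injective (cong (λ s → lookup s zero) same)))

theorem6 : (d : ℕ) → 2 ≤ d → DominationNumber (cDB d 2 2) (d ∸ 1)
theorem6 (suc (suc e)) (s≤s (s≤s z≤n)) =
  ( star e
  , star-distinct e
  , star-dominating e
  , length-tabulate (star-vertex e) )
  , dominating⇒≥ (suc (suc e))
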